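{- Let $\mathcal K = (S, \to, I, AP, \ell)$ be an unlabeled Kripke structure with total transition relation, let $s \in S$ and let $\Phi$ be a CTL* state formula. Then $\mathcal K, s \vDash \Phi$ in the classical CTL* semantics if and only if $\Gamma^\omega_{\mathcal K, s} \vDash \Phi$ in the strategy-controlled CTL* semantics.
   Context: $\Gamma^\omega_{\mathcal K, s} \subseteq S^\omega$ is the set of infinite executions $s_0 s_1 s_2 \cdots$ of $\mathcal K$ with $s_0 = s$ and $s_k \to s_{k+1}$. CTL* state formulae: $\Phi ::= \bot \mid \top \mid p \mid \neg \Phi \mid \Phi \wedge \Phi \mid \Phi \vee \Phi \mid \mathbf{A}\phi \mid \mathbf{E}\phi$ ($p \in AP$); path formulae: $\phi ::= \Phi \mid \neg\phi \mid \phi\wedge\phi \mid \phi \vee\phi \mid \mathbf{X}\phi \mid \mathbf{F}\phi \mid \mathbf{G}\phi \mid \phi\,\mathbf{U}\,\phi$. For a set $E$ of executions and a finite word $ws$ ($s \in S$), let $E/ws = \{ s\pi : ws\pi \in E\}$. For $\pi = \pi_0\pi_1\cdots$ let $\pi^k = \pi_k\pi_{k+1}\cdots$ and $\pi[0..n] = \pi_0\cdots\pi_n$. The strategy-controlled semantics defines $E \vDash \Phi$ for sets $E \subseteq S^\omega$ and $E, \pi \vDash \phi$ for $\pi \in E$: $E \vDash p$ iff $p \in \ell(\pi_0)$ for all $\pi \in E$; $E \vDash \neg\Phi$ iff $E \not\vDash \Phi$; $E \vDash \Phi_1 \wedge \Phi_2$ iff both hold; $E \vDash \mathbf{E}\phi$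 iff there is $\pi \in E$ with $(E/\pi_0), \pi \vDash \phi$; $E, \pi \vDash \Phi$ iff $E \vDash \Phi$; $E,\pi \vDash \neg\phi$ iff $E,\pi\not\vDash\phi$; $E,\pi\vDash\phi_1\wedge\phi_2$ iff both hold; $E, \pi \vDash \mathbf{X}\phi$ iff $(E/\pi_0\pi_1), \pi^1 \vDash \phi$; $E, \pi \vDash \phi_1 \,\mathbf{U}\, \phi_2$ iff there is $n \ge 0$ with $(E/\pi[0..n]), \pi^n \vDash \phi_2$ and $(E/\pi[0..k]), \pi^k \vDash \phi_1$ for all $0 \le k < n$. The remaining operators ($\bot,\top,\vee,\mathbf{A},\mathbf{F},\mathbf{G}$) are defined by the usual equivalences. The classical semantics $\mathcal K, s \vDash \Phi$ is the standard CTL* semantics over infinite paths of $\mathcal K$. -}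

module Defs where

open import Data.Nat using (ℕ; zero; suc; _+_; _<_)
open import Data.List using (List; []; _∷_)
open import Data.Product using (Σ; ∃; _×_)
open import Data.Empty renaming (⊥ to Empty)
open import Data.Unit renaming (⊤ to Unit)
open import Relation.Nullary using (¬_)
open import Relation.Binary.PropositionalEquality using (_≡_)

record Kripke : Set₁ where
  field
    S   : Set
    _⇒_ : S → S → Set
    I   : S → Set               -- initial states (unused by the statement)
    AP  : Set
    ℓ   : S → AP → Set          -- ℓ s p  means  p ∈ ℓ(s)

Total : Kripke → Set
Total K = ∀ s → ∃ λ s' → s ⇒ s'
  where open Kripke K

mutual
  data StateF (AP : Set) : Set where
    ⊥F ⊤F : StateF AP
    atom  : AP → StateF AP
    ¬S_   : StateF AP → StateF AP
    _∧S_  : StateF AP → StateF AP → StateF AP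
    _∨S_  : StateF AP → StateF AP → StateF AP
    𝐀 𝐄   : PathF AP → StateF AP

  data PathF (AP : Set) : Set where
    st   : StateF AP → PathF AP
    ¬P_  : PathF AP → PathF AP
    _∧P_ : PathF AP → PathF AP → PathF AP
    _∨P_ : PathF AP → PathF AP → PathF AP
    𝐗 𝐅 𝐆 : PathF AP → PathF AP
    _𝐔_  : PathF AP → PathF AP → PathF AP

module Semantics (K : Kripke) where
  open Kripke K

  Stream : Set
  Stream = ℕ → S

  drop : ℕ → Stream → Stream
  drop n π k = π (n + k)

  -- π[0..n-1] as a list (so π[0..n] = take n π followed by π n)
  take : ℕ → Stream → List S
  take zero    π = []
  take (suc n) π = π 0 ∷ take n (λ k → π (suc k))

  _++ˢ_ : List S → Stream → Stream
  ([]     ++ˢ ρ) k       = ρ k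
  ((x ∷ w) ++ˢ ρ) zero    = x
  ((x ∷ w) ++ˢ ρ) (suc k) = (w ++ˢ ρ) k

  Execs : Set₁
  Execs = Stream → Set

  _/_∙_ : Execs → List S → S → Execs
  (E / w ∙ s) ρ = (ρ 0 ≡ s) × E (w ++ˢ ρ)

  _/pre_at_ : Execs → Stream → ℕ → Execs
  E /pre π at n = E / take n π ∙ π n

  Γ : S → Execs
  Γ s π = (π 0 ≡ s) × (∀ k → π k ⇒ π (suc k))

  -- strategy-controlled semantics
  -- (⊥, ⊤, ∨, 𝐀, 𝐅, 𝐆 via the usual equivalences:
  --  Φ∨Ψ = ¬(¬Φ∧¬Ψ), 𝐀φ = ¬𝐄¬φ, 𝐅φ = ⊤ 𝐔 φ, 𝐆φ = ¬𝐅¬φ)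

  mutual
    _⊨_ : Execs → StateF AP → Set
    E ⊨ ⊥F       = Empty
    E ⊨ ⊤F       = Unit
    E ⊨ atom p   = ∀ π → E π → ℓ (π 0) p
    E ⊨ (¬S Φ)   = ¬ (E ⊨ Φ)
    E ⊨ (Φ ∧S Ψ) = (E ⊨ Φ) × (E ⊨ Ψ)
    E ⊨ (Φ ∨S Ψ) = ¬ ((¬ (E ⊨ Φ)) × (¬ (E ⊨ Ψ)))
    E ⊨ 𝐄 φ      = Σ Stream λ π → E π × ((E / [] ∙ π 0) , π ⊨ᵖ φ)
    E ⊨ 𝐀 φ      = ¬ (Σ Stream λ π → E π × ¬ ((E / [] ∙ π 0) , π ⊨ᵖ φ))

    _,_⊨ᵖ_ : Execs → Stream → PathF AP → Set
    E , π ⊨ᵖ st Φ     = E ⊨ Φ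
    E , π ⊨ᵖ (¬P φ)   = ¬ (E , π ⊨ᵖ φ)
    E , π ⊨ᵖ (φ ∧P ψ) = (E , π ⊨ᵖ φ) × (E , π ⊨ᵖ ψ)
    E , π ⊨ᵖ (φ ∨P ψ) = ¬ ((¬ (E , π ⊨ᵖ φ)) × (¬ (E , π ⊨ᵖ ψ)))
    E , π ⊨ᵖ 𝐗 φ      = (E /pre π at 1) , drop 1 π ⊨ᵖ φ
    E , π ⊨ᵖ (φ 𝐔 ψ)  = Σ ℕ λ n → ((E /pre π at n) , drop n π ⊨ᵖ ψ)
                          × (∀ k → k < n → (E /pre π at k) , drop k π ⊨ᵖ φ)
    E , π ⊨ᵖ 𝐅 φ      = Σ ℕ λ n → ((E /pre π at n) , drop n π ⊨ᵖ φ)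
                          × (∀ k → k < n → Unit)
    E , π ⊨ᵖ 𝐆 φ      = ¬ (Σ ℕ λ n → (¬ ((E /pre π at n) , drop n π ⊨ᵖ φ))
                          × (∀ k → k < n → Unit))

  mutual
    _⊨ᶜ_ : S → StateF AP → Set
    s ⊨ᶜ ⊥F       = Empty
    s ⊨ᶜ ⊤F       = Unit
    s ⊨ᶜ atom p   = ℓ s p
    s ⊨ᶜ (¬S Φ)   = ¬ (s ⊨ᶜ Φ)
    s ⊨ᶜ (Φ ∧S Ψ) = (s ⊨ᶜ Φ) × (s ⊨ᶜ Ψ)
    s ⊨ᶜ (Φ ∨S Ψ) = ¬ ((¬ (s ⊨ᶜ Φ)) × (¬ (s ⊨ᶜ Ψ)))
    s ⊨ᶜ 𝐄 φ      = Σ Stream λ π → Γ s π × (π ⊨ᶜᵖ φ)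
    s ⊨ᶜ 𝐀 φ      = ¬ (Σ Stream λ π → Γ s π × ¬ (π ⊨ᶜᵖ φ))

    _⊨ᶜᵖ_ : Stream → PathF AP → Set
    π ⊨ᶜᵖ st Φ     = π 0 ⊨ᶜ Φ
    π ⊨ᶜᵖ (¬P φ)   = ¬ (π ⊨ᶜᵖ φ)
    π ⊨ᶜᵖ (φ ∧P ψ) = (π ⊨ᶜᵖ φ) × (π ⊨ᶜᵖ ψ)
    π ⊨ᶜᵖ (φ ∨P ψ) = ¬ ((¬ (π ⊨ᶜᵖ φ)) × (¬ (π ⊨ᶜᵖ ψ)))
    π ⊨ᶜᵖ 𝐗 φ      = drop 1 π ⊨ᶜᵖ φ
    π ⊨ᶜᵖ (φ 𝐔 ψ)  = Σ ℕ λ n → (drop n π ⊨ᶜᵖ ψ)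
                       × (∀ k → k < n → drop k π ⊨ᶜᵖ φ)
    π ⊨ᶜᵖ 𝐅 φ      = Σ ℕ λ n → (drop n π ⊨ᶜᵖ φ) × (∀ k → k < n → Unit)
    π ⊨ᶜᵖ 𝐆 φ      = ¬ (Σ ℕ λ n → (¬ (drop n π ⊨ᶜᵖ φ)) × (∀ k → k < n → Unit))

{-# OPTIONS --safe #-}
module Submission where

-- The residual of Γ_t along a prefix of one of its executions π is again of
-- this form: Γ_t / π[0..n] = Γ_{π n}.  So a simultaneous induction on state
-- and path formulae shows that at any E equal (as a set) to Γ_t the
-- strategy-controlled semantics agrees with the classical semantics at t,
-- and along π ∈ Γ_t with the classical semantics on π.

open import Defs
open import Data.Nat using (ℕ; zero; suc; _+_; _<_)
open import Data.Nat.Properties using (+-identityʳ; +-suc)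
open import Data.List using ([]; _∷_)
open import Data.Product using (Σ; _×_; _,_; proj₁; proj₂)
open import Data.Product.Function.Dependent.Propositional using (congˡ)
open import Data.Product.Function.NonDependent.Propositional using (_×-⇔_)
open import Function.Base using (_∘_)
open import Function.Bundles using (_⇔_; mk⇔; Equivalence)
open import Function.Construct.Identity using (⇔-id)
open import Function.Related.Propositional using (equivalence)
open import Function.Related.TypeIsomorphisms using (¬-cong-⇔)
open import Relation.Binary.PropositionalEquality using (_≡_; refl; sym; trans; cong; subst)
open import Level using (0ℓ)
open import Relation.Unary using (Pred; _≐_)
open import Relation.Unary.Properties using (≐-trans)

open Equivalence using (to; from)

dependent-×-⇔ : {A A′ B B′ : Set} → A ⇔ A′ → (A → B ⇔ B′) → (A × B) ⇔ (A′ × B′)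
dependent-×-⇔ A⇔A′ B⇔B′ = mk⇔
  (λ (a , b) → to A⇔A′ a , to (B⇔B′ a) b)
  (λ (a′ , b′) → from A⇔A′ a′ , from (B⇔B′ (from A⇔A′ a′)) b′)

until-cong-⇔ : {A A′ B B′ : ℕ → Set} → (∀ n → A n ⇔ A′ n) → (∀ k → B k ⇔ B′ k) →
               (Σ ℕ λ n → A n × (∀ k → k < n → B k)) ⇔ (Σ ℕ λ n → A′ n × (∀ k → k < n → B′ k))
until-cong-⇔ A⇔A′ B⇔B′ = congˡ {k = equivalence} λ {n} → A⇔A′ n ×-⇔ mk⇔
  (λ b k k<n → to (B⇔B′ k) (b k k<n))
  (λ b′ k k<n → from (B⇔B′ k) (b′ k k<n))

≐⇒⇔ : {A : Set} {P Q : Pred A 0ℓ} → P ≐ Q → ∀ {x} → P x ⇔ Q x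
≐⇒⇔ (P⊆Q , Q⊆P) = mk⇔ P⊆Q Q⊆P

module _ (K : Kripke) where
  open Kripke K
  open Semantics K

  Execution : Stream → Set
  Execution π = ∀ k → π k ⇒ π (suc k)

  take-++ˢ-head : ∀ n {π ρ : Stream} → ρ 0 ≡ π n → (take n π ++ˢ ρ) 0 ≡ π 0
  take-++ˢ-head zero    ρ₀≡πₙ = ρ₀≡πₙ
  take-++ˢ-head (suc n) _     = refl

  take-++ˢ-execution : ∀ n {π ρ : Stream} → Execution π → ρ 0 ≡ π n → Execution ρ →
                       Execution (take n π ++ˢ ρ)
  take-++ˢ-execution zero    _      _     ρ-exec = ρ-exec
  take-++ˢ-execution (suc n) {π} π-exec ρ₀≡πₙ ρ-exec zero =
    subst (π 0 ⇒_) (sym (take-++ˢ-head n ρ₀≡πₙ)) (π-exec 0)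
  take-++ˢ-execution (suc n) π-exec ρ₀≡πₙ ρ-exec (suc k) =
    take-++ˢ-execution n (π-exec ∘ suc) ρ₀≡πₙ ρ-exec k

  ++ˢ-execution⁻ : ∀ w {ρ : Stream} → Execution (w ++ˢ ρ) → Execution ρ
  ++ˢ-execution⁻ []      exec = exec
  ++ˢ-execution⁻ (_ ∷ w) exec = ++ˢ-execution⁻ w (exec ∘ suc)

  drop-execution : ∀ n {π : Stream} → Execution π → Execution (drop n π)
  drop-execution n {π} exec k = subst (λ m → π (n + k) ⇒ π m) (sym (+-suc n k)) (exec (n + k))

  Γ-drop : ∀ {t π} → Γ t π → ∀ n → Γ (π n) (drop n π)
  Γ-drop {π = π} (_ , exec) n = cong π (+-identityʳ n) , drop-execution n exec

  Γ-/pre : ∀ {t π} → Γ t π → ∀ n → Γ (π n) ≐ (Γ t /pre π at n)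
  Γ-/pre {π = π} (π₀≡t , π-exec) n =
    (λ (ρ₀≡πₙ , ρ-exec) →
       ρ₀≡πₙ , trans (take-++ˢ-head n ρ₀≡πₙ) π₀≡t , take-++ˢ-execution n π-exec ρ₀≡πₙ ρ-exec) ,
    (λ (ρ₀≡πₙ , _ , exec) → ρ₀≡πₙ , ++ˢ-execution⁻ (take n π) exec)

  /-cong : ∀ {E F : Execs} {w s} → E ≐ F → (E / w ∙ s) ≐ (F / w ∙ s)
  /-cong (E⊆F , F⊆E) = (λ (ρ₀≡s , e) → ρ₀≡s , E⊆F e) , (λ (ρ₀≡s , f) → ρ₀≡s , F⊆E f)

  Γ≐-/pre : ∀ {t π E} → Γ t π → Γ t ≐ E → ∀ n → Γ (π n) ≐ (E /pre π at n)
  Γ≐-/pre {π = π} γ Γ≐E n = ≐-trans (Γ-/pre γ n) (/-cong {w = take n π} Γ≐E)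

  module _ (total : Total K) where

    execution-from : S → Stream
    execution-from t zero    = t
    execution-from t (suc n) = proj₁ (total (execution-from t n))

    Γ-execution-from : ∀ t → Γ t (execution-from t)
    Γ-execution-from t = refl , λ k → proj₂ (total (execution-from t k))

    mutual
      ⊨ᶜ⇔⊨ : ∀ Φ {t E} → Γ t ≐ E → (t ⊨ᶜ Φ) ⇔ (E ⊨ Φ)
      ⊨ᶜ⇔⊨ ⊥F       _   = mk⇔ (λ ()) (λ ())
      ⊨ᶜ⇔⊨ ⊤F       _   = ⇔-id _
      -- Totality makes Γ t, and hence E, nonempty, so E ⊨ p is not vacuous.
      ⊨ᶜ⇔⊨ (atom p) {t} (Γ⊆E , E⊆Γ) = mk⇔
        (λ p∈ℓt π π∈E → subst (λ u → ℓ u p) (sym (proj₁ (E⊆Γ π∈E))) p∈ℓt)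
        (λ h → h (execution-from t) (Γ⊆E (Γ-execution-from t)))
      ⊨ᶜ⇔⊨ (¬S Φ)   Γ≐E = ¬-cong-⇔ (⊨ᶜ⇔⊨ Φ Γ≐E)
      ⊨ᶜ⇔⊨ (Φ ∧S Ψ) Γ≐E = ⊨ᶜ⇔⊨ Φ Γ≐E ×-⇔ ⊨ᶜ⇔⊨ Ψ Γ≐E
      ⊨ᶜ⇔⊨ (Φ ∨S Ψ) Γ≐E = ¬-cong-⇔ (¬-cong-⇔ (⊨ᶜ⇔⊨ Φ Γ≐E) ×-⇔ ¬-cong-⇔ (⊨ᶜ⇔⊨ Ψ Γ≐E))
      ⊨ᶜ⇔⊨ (𝐄 φ)    Γ≐E = congˡ {k = equivalence}
        (dependent-×-⇔ (≐⇒⇔ Γ≐E) λ γ → ⊨ᶜᵖ⇔⊨ᵖ-suffix φ γ Γ≐E 0)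
      ⊨ᶜ⇔⊨ (𝐀 φ)    Γ≐E = ¬-cong-⇔ (congˡ {k = equivalence}
        (dependent-×-⇔ (≐⇒⇔ Γ≐E) λ γ → ¬-cong-⇔ (⊨ᶜᵖ⇔⊨ᵖ-suffix φ γ Γ≐E 0)))

      ⊨ᶜᵖ⇔⊨ᵖ : ∀ φ {t π E} → Γ t π → Γ t ≐ E → (π ⊨ᶜᵖ φ) ⇔ (E , π ⊨ᵖ φ)
      ⊨ᶜᵖ⇔⊨ᵖ (st Φ)   (π₀≡t , _) Γ≐E = ⊨ᶜ⇔⊨ Φ (subst (λ u → Γ u ≐ _) (sym π₀≡t) Γ≐E)
      ⊨ᶜᵖ⇔⊨ᵖ (¬P φ)   γ Γ≐E = ¬-cong-⇔ (⊨ᶜᵖ⇔⊨ᵖ φ γ Γ≐E)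
      ⊨ᶜᵖ⇔⊨ᵖ (φ ∧P ψ) γ Γ≐E = ⊨ᶜᵖ⇔⊨ᵖ φ γ Γ≐E ×-⇔ ⊨ᶜᵖ⇔⊨ᵖ ψ γ Γ≐E
      ⊨ᶜᵖ⇔⊨ᵖ (φ ∨P ψ) γ Γ≐E =
        ¬-cong-⇔ (¬-cong-⇔ (⊨ᶜᵖ⇔⊨ᵖ φ γ Γ≐E) ×-⇔ ¬-cong-⇔ (⊨ᶜᵖ⇔⊨ᵖ ψ γ Γ≐E))
      ⊨ᶜᵖ⇔⊨ᵖ (𝐗 φ)    γ Γ≐E = ⊨ᶜᵖ⇔⊨ᵖ-suffix φ γ Γ≐E 1
      ⊨ᶜᵖ⇔⊨ᵖ (𝐅 φ)    γ Γ≐E = until-cong-⇔ (⊨ᶜᵖ⇔⊨ᵖ-suffix φ γ Γ≐E) (λ _ → ⇔-id _)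
      ⊨ᶜᵖ⇔⊨ᵖ (𝐆 φ)    γ Γ≐E = ¬-cong-⇔
        (until-cong-⇔ (¬-cong-⇔ ∘ ⊨ᶜᵖ⇔⊨ᵖ-suffix φ γ Γ≐E) (λ _ → ⇔-id _))
      ⊨ᶜᵖ⇔⊨ᵖ (φ 𝐔 ψ)  γ Γ≐E =
        until-cong-⇔ (⊨ᶜᵖ⇔⊨ᵖ-suffix ψ γ Γ≐E) (⊨ᶜᵖ⇔⊨ᵖ-suffix φ γ Γ≐E)

      ⊨ᶜᵖ⇔⊨ᵖ-suffix : ∀ φ {t π E} → Γ t π → Γ t ≐ E → ∀ n →
                      (drop n π ⊨ᶜᵖ φ) ⇔ ((E /pre π at n) , drop n π ⊨ᵖ φ)
      ⊨ᶜᵖ⇔⊨ᵖ-suffix φ γ Γ≐E n = ⊨ᶜᵖ⇔⊨ᵖ φ (Γ-drop γ n) (Γ≐-/pre γ Γ≐E n)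

proposition1 : (K : Kripke) → Total K → (s : Kripke.S K) → (Φ : StateF (Kripke.AP K))
    → let open Semantics K in (s ⊨ᶜ Φ) ⇔ (Γ s ⊨ Φ)
proposition1 K total s Φ = ⊨ᶜ⇔⊨ K total Φ ((λ γ → γ) , (λ γ → γ))
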